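{- For any simple graph $G$ of order $p$ and any $0\le k\le p$, $$w_k(G)=\sum_{i\le k}(-1)^{k-i}\binom{p-i}{p-k}\,i!\,a_i(G).$$
   Context: $\chi(G,x)$ is the chromatic polynomial of $G$. The numbers $a_i(G)$ are defined by $\chi(G,x)=\sum_{0\le i\le p}a_i(G)(x)_i$ with $(x)_i=x(x-1)\cdots(x-i+1)$. The numbers $w_i(G)$ are defined by $\chi(G,x)=\sum_{0\le i\le p}w_i(G)\binom{x+p-i}{p}$. -}

module Defs where

open import Data.Bool using (Bool; true; false; _∧_; not; if_then_else_)
open import Data.Nat using (ℕ; zero; suc; _∸_) renaming (_+_ to _+ℕ_; _*_ to _*ℕ_)
open import Data.Fin using (Fin; zero; suc; _≟_)
open import Data.Fin.Base using ()
open import Data.Vec using (Vec; []; _∷_; lookup)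
open import Data.List using (List; []; _∷_; _++_; map; concatMap; filter; length; allFin)
open import Data.Bool.ListAction using (and)
open import Data.Integer using (ℤ; +_; -_; _+_; _*_; 0ℤ; 1ℤ)
open import Relation.Nullary.Decidable using (⌊_⌋)
import Relation.Nullary
import Data.Bool
open import Relation.Binary.PropositionalEquality using (_≡_)

record SimpleGraph (p : ℕ) : Set where
  field
    adj   : Fin p → Fin p → Bool
    sym   : ∀ u v → adj u v ≡ adj v u
    loopless : ∀ v → adj v v ≡ false
open SimpleGraph public

allColourings : (x p : ℕ) → List (Vec (Fin x) p)
allColourings x zero = [] ∷ []
allColourings x (suc p) = concatMap (λ c → map (c ∷_) (allColourings x p)) (allFin x)

isProper : ∀ {p x} → SimpleGraph p → Vec (Fin x) p → Bool
isProper {p} G c =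
  and (concatMap (λ u → map (λ v → not (adj G u v ∧ ⌊ lookup c u ≟ lookup c v ⌋)) (allFin p)) (allFin p))

-- Chromatic polynomial evaluated at x ∈ ℕ: number of proper x-colourings.
chromatic : ∀ {p} → SimpleGraph p → ℕ → ℕ
chromatic {p} G x = length (filter (λ c → isProper G c ≡? true) (allColourings x p))
  where
  _≡?_ : (a b : Bool) → Relation.Nullary.Dec (a ≡ b)
  _≡?_ = Data.Bool._≟_

fall : ℕ → ℕ → ℕ
fall x zero = 1
fall x (suc i) = fall x i *ℕ (x ∸ i)

sumTo : ℕ → (ℕ → ℤ) → ℤ
sumTo zero f = 0ℤ
sumTo (suc n) f = sumTo n f + f n

signPow : ℕ → ℤ
signPow zero = 1ℤ
signPow (suc n) = - signPow n

-- The aᵢ and the wᵢ are coefficients of one polynomial in two bases, so it suffices to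
-- check that the claimed coefficients reproduce Σ aᵢ (x)ᵢ at x = 0, …, p: the basis
-- C(x + p − i, p) is unitriangular on these points, so coefficients agreeing there are equal.
-- Substituting (x)ⱼ = j! C(x, j) and exchanging sums, the check reduces to the inversion identity
-- Σᵢ (−1)^(i−j) C(p − j, p − i) C(x + p − i, p) = C(x, j), a coefficient of
-- (1 − t)^(p−j) / (1 − t)^(p+1) = 1 / (1 − t)^(j+1).
module Submission where

open import Defs hiding (sym)
open import Data.Nat using (ℕ; suc; _∸_; _≤_) renaming (_+_ to _+ℕ_)
open import Data.Nat.Combinatorics using (_C_)
open import Data.Nat using (_!)
open import Data.Integer using (ℤ; +_; _*_)
open import Relation.Binary.PropositionalEquality using (_≡_)

open import Data.Nat using (zero; _<_; s≤s) renaming (_*_ to _*ℕ_)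
open import Data.Nat.Properties as ℕ using (_!≢0)
open import Data.Nat.Combinatorics as ℕC using (_P_)
open import Data.Nat.Combinatorics.Base using (_P′_)
import Data.Nat.Combinatorics.Specification as ℕCS
open import Data.Nat.DivMod using (_/_; m*[n/m]≡n)
open import Data.Nat.Induction using (<-rec)
open import Data.Integer using (_+_; -_; 0ℤ; 1ℤ)
import Data.Integer.Properties as ℤ
open import Algebra.Properties.AbelianGroup ℤ.+-0-abelianGroup using (∙-cancelˡ)
open import Data.Integer.Tactic.RingSolver using (solve-∀)
open import Data.Product using (_,_)
open import Relation.Nullary using (yes; no)
open import Relation.Binary.PropositionalEquality
  using (refl; sym; trans; cong; cong₂; module ≡-Reasoning)

private
  variable
    f g : ℕ → ℤ

sumTo-cong : ∀ n → (∀ i → i < n → f i ≡ g i) → sumTo n f ≡ sumTo n g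
sumTo-cong zero    eq = refl
sumTo-cong (suc n) eq =
  cong₂ _+_ (sumTo-cong n (λ i i<n → eq i (ℕ.m<n⇒m<1+n i<n))) (eq n ℕ.≤-refl)

sumTo-0 : ∀ n → (∀ i → i < n → f i ≡ 0ℤ) → sumTo n f ≡ 0ℤ
sumTo-0 n eq = trans (sumTo-cong {g = λ _ → 0ℤ} n eq) (sumTo-const0 n)
  where
  sumTo-const0 : ∀ n → sumTo n (λ _ → 0ℤ) ≡ 0ℤ
  sumTo-const0 zero    = refl
  sumTo-const0 (suc n) = cong (_+ 0ℤ) (sumTo-const0 n)

sumTo-+ : ∀ n (f g : ℕ → ℤ) → sumTo n (λ i → f i + g i) ≡ sumTo n f + sumTo n g
sumTo-+ zero    f g = refl
sumTo-+ (suc n) f g =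
  trans (cong (_+ (f n + g n)) (sumTo-+ n f g)) (interchange (sumTo n f) (sumTo n g) (f n) (g n))
  where
  interchange : ∀ a b c d → (a + b) + (c + d) ≡ (a + c) + (b + d)
  interchange = solve-∀

sumTo-neg : ∀ n (f : ℕ → ℤ) → sumTo n (λ i → - f i) ≡ - sumTo n f
sumTo-neg zero    f = refl
sumTo-neg (suc n) f =
  trans (cong (_+ - f n) (sumTo-neg n f)) (sym (ℤ.neg-distrib-+ (sumTo n f) (f n)))

sumTo-*ʳ : ∀ n (f : ℕ → ℤ) c → sumTo n (λ i → f i * c) ≡ sumTo n f * c
sumTo-*ʳ zero    f c = sym (ℤ.*-zeroˡ c)
sumTo-*ʳ (suc n) f c =
  trans (cong (_+ f n * c) (sumTo-*ʳ n f c)) (sym (ℤ.*-distribʳ-+ c (sumTo n f) (f n)))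

sumTo-sucˡ : ∀ n (f : ℕ → ℤ) → sumTo (suc n) f ≡ f 0 + sumTo n (λ i → f (suc i))
sumTo-sucˡ zero    f = trans (ℤ.+-identityˡ (f 0)) (sym (ℤ.+-identityʳ (f 0)))
sumTo-sucˡ (suc n) f = trans (cong (_+ f (suc n)) (sumTo-sucˡ n f)) (ℤ.+-assoc (f 0) _ _)

sumTo-split : ∀ m n (f : ℕ → ℤ) → sumTo (m +ℕ n) f ≡ sumTo m f + sumTo n (λ r → f (m +ℕ r))
sumTo-split m zero f rewrite ℕ.+-identityʳ m = sym (ℤ.+-identityʳ (sumTo m f))
sumTo-split m (suc n) f rewrite ℕ.+-suc m n =
  trans (cong (_+ f (m +ℕ n)) (sumTo-split m n f)) (ℤ.+-assoc (sumTo m f) _ _)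

sumTo-comm : ∀ m n (F : ℕ → ℕ → ℤ) →
  sumTo m (λ i → sumTo n (F i)) ≡ sumTo n (λ j → sumTo m (λ i → F i j))
sumTo-comm zero    n F = sym (sumTo-0 n (λ _ _ → refl))
sumTo-comm (suc m) n F =
  trans (cong (_+ sumTo n (F m)) (sumTo-comm m n F)) (sym (sumTo-+ n (λ j → sumTo m (λ i → F i j)) (F m)))

sumTo-truncate : ∀ {m n} → m ≤ n → (∀ i → m ≤ i → i < n → f i ≡ 0ℤ) →
                 sumTo n f ≡ sumTo m f
sumTo-truncate {f = f} {m} m≤n tailVanishes with ℕ.m≤n⇒∃[o]m+o≡n m≤n
... | d , refl = begin
  sumTo (m +ℕ d) f                            ≡⟨ sumTo-split m d f ⟩
  sumTo m f + sumTo d (λ r → f (m +ℕ r))      ≡⟨ cong (_+_ (sumTo m f)) (sumTo-0 d tailVanishes′) ⟩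
  sumTo m f + 0ℤ                              ≡⟨ ℤ.+-identityʳ (sumTo m f) ⟩
  sumTo m f                                   ∎
  where
  open ≡-Reasoning
  tailVanishes′ : ∀ r → r < d → f (m +ℕ r) ≡ 0ℤ
  tailVanishes′ r r<d = tailVanishes (m +ℕ r) (ℕ.m≤m+n m r) (ℕ.+-monoʳ-< m r<d)

C-∸-vanishes : ∀ {p i j} → i < j → j ≤ p → (p ∸ j) C (p ∸ i) ≡ 0
C-∸-vanishes {p} {i} {j} i<j j≤p = ℕCS.k>n⇒nCk≡0 (ℕ.∸-monoʳ-< {p} {j} {i} i<j j≤p)

fall≡P′ : ∀ n k → fall n k ≡ n P′ k
fall≡P′ n zero    = refl
fall≡P′ n (suc k) = trans (cong (_*ℕ (n ∸ k)) (fall≡P′ n k)) (ℕ.*-comm (n P′ k) (n ∸ k))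

fall-vanishes : ∀ {n k} → n < k → fall n k ≡ 0
fall-vanishes {n} {suc k} (s≤s n≤k) rewrite ℕ.m≤n⇒m∸n≡0 n≤k = ℕ.*-zeroʳ (fall n k)

fall≡!*C : ∀ n k → fall n k ≡ k ! *ℕ (n C k)
fall≡!*C n k with k ℕ.≤? n
... | no k≰n rewrite ℕCS.k>n⇒nCk≡0 (ℕ.≰⇒> k≰n) =
  trans (fall-vanishes (ℕ.≰⇒> k≰n)) (sym (ℕ.*-zeroʳ (k !)))
... | yes k≤n = begin
  fall n k                 ≡⟨ fall≡P′ n k ⟩
  n P′ k                   ≡⟨ m*[n/m]≡n (ℕCS.k!∣nP′k k≤n) ⟨
  k ! *ℕ ((n P′ k) / k !)  ≡⟨ cong (λ m → k ! *ℕ (m / k !)) P′≡P ⟩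
  k ! *ℕ ((n P k) / k !)   ≡⟨ cong (k ! *ℕ_) (ℕC.nCk≡nPk/k! k≤n) ⟨
  k ! *ℕ (n C k)           ∎
  where
  open ≡-Reasoning
  instance
    _ = k !≢0
    _ = (n ∸ k) !≢0
  P′≡P : n P′ k ≡ n P k
  P′≡P = trans (ℕCS.nP′k≡n!/[n∸k]! k≤n) (sym (ℕC.nPk≡n!/[n∸k]! k≤n))

pascal-ℤ : ∀ m k → + (suc m C suc k) ≡ + (m C k) + + (m C suc k)
pascal-ℤ m k = trans (cong +_ (sym (ℕC.nCk+nC[k+1]≡[n+1]C[k+1] m k))) (ℤ.pos-+ (m C k) (m C suc k))

-- The coefficient of tˢ in (1 − t)ⁿ / (1 − t)^(M+1).
alternatingConvolution : ℕ → ℕ → ℕ → ℤ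
alternatingConvolution n M s =
  sumTo (suc s) (λ r → signPow r * (+ (n C r) * + ((s ∸ r +ℕ M) C M)))

alternatingConvolution-suc : ∀ n M s →
  alternatingConvolution (suc n) M (suc s) ≡
  alternatingConvolution n M (suc s) + - alternatingConvolution n M s
alternatingConvolution-suc n M s = begin
  sumTo (suc (suc s)) next
    ≡⟨ sumTo-sucˡ (suc s) next ⟩
  next 0 + sumTo (suc s) (λ r → next (suc r))
    ≡⟨ cong (_+_ (next 0)) (sumTo-cong (suc s) (λ r _ → splitRow r)) ⟩
  next 0 + sumTo (suc s) (λ r → here (suc r) + - before r)
    ≡⟨ cong (_+_ (next 0)) (sumTo-+ (suc s) (λ r → here (suc r)) (λ r → - before r)) ⟩
  next 0 + (sumTo (suc s) (λ r → here (suc r)) + sumTo (suc s) (λ r → - before r))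
    ≡⟨ cong (λ b → next 0 + (sumTo (suc s) (λ r → here (suc r)) + b)) (sumTo-neg (suc s) before) ⟩
  here 0 + (sumTo (suc s) (λ r → here (suc r)) + - sumTo (suc s) before)
    ≡⟨ ℤ.+-assoc (here 0) _ _ ⟨
  (here 0 + sumTo (suc s) (λ r → here (suc r))) + - sumTo (suc s) before
    ≡⟨ cong (_+ - sumTo (suc s) before) (sumTo-sucˡ (suc s) here) ⟨
  sumTo (suc (suc s)) here + - sumTo (suc s) before
    ∎
  where
  open ≡-Reasoning
  X : ℕ → ℤ
  X m = + ((m +ℕ M) C M)
  next here before : ℕ → ℤ
  next   r = signPow r * (+ (suc n C r) * X (suc s ∸ r))
  here   r = signPow r * (+ (n C r) * X (suc s ∸ r))
  before r = signPow r * (+ (n C r) * X (s ∸ r))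
  distribute : ∀ σ a b x → - σ * ((a + b) * x) ≡ - σ * (b * x) + - (σ * (a * x))
  distribute = solve-∀
  splitRow : ∀ r → next (suc r) ≡ here (suc r) + - before r
  splitRow r = trans (cong (λ c → - signPow r * (c * X (s ∸ r))) (pascal-ℤ n r))
    (distribute (signPow r) (+ (n C r)) (+ (n C suc r)) (X (s ∸ r)))

alternatingConvolution-collapse : ∀ n j s →
  alternatingConvolution n (n +ℕ j) s ≡ + ((s +ℕ j) C j)
alternatingConvolution-collapse zero j s = begin
  sumTo (suc s) term
    ≡⟨ sumTo-sucˡ s term ⟩
  term 0 + sumTo s (λ r → term (suc r))
    ≡⟨ cong (_+_ (term 0)) (sumTo-0 s (λ r _ → ℤ.*-zeroʳ (signPow (suc r)))) ⟩
  term 0 + 0ℤ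
    ≡⟨ ℤ.+-identityʳ (term 0) ⟩
  1ℤ * (1ℤ * binomial)
    ≡⟨ trans (ℤ.*-identityˡ (1ℤ * binomial)) (ℤ.*-identityˡ binomial) ⟩
  binomial
    ∎
  where
  open ≡-Reasoning
  term : ℕ → ℤ
  term r = signPow r * (+ (0 C r) * + ((s ∸ r +ℕ j) C j))
  binomial : ℤ
  binomial = + ((s +ℕ j) C j)
alternatingConvolution-collapse (suc n) j zero
  rewrite ℕC.nCn≡1 (suc n +ℕ j) | ℕC.nCn≡1 j = refl
alternatingConvolution-collapse (suc n) j (suc s) = begin
  alternatingConvolution (suc n) (suc n +ℕ j) (suc s)
    ≡⟨ cong (λ M → alternatingConvolution (suc n) M (suc s)) (ℕ.+-suc n j) ⟨
  alternatingConvolution (suc n) (n +ℕ suc j) (suc s)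
    ≡⟨ alternatingConvolution-suc n (n +ℕ suc j) s ⟩
  alternatingConvolution n (n +ℕ suc j) (suc s) + - alternatingConvolution n (n +ℕ suc j) s
    ≡⟨ cong₂ (λ a b → a + - b) (alternatingConvolution-collapse n (suc j) (suc s))
                               (alternatingConvolution-collapse n (suc j) s) ⟩
  + (suc m C suc j) + - + (m C suc j)
    ≡⟨ cong (_+ - + (m C suc j)) (pascal-ℤ m j) ⟩
  (+ (m C j) + + (m C suc j)) + - + (m C suc j)
    ≡⟨ cancel (+ (m C j)) (+ (m C suc j)) ⟩
  + (m C j)
    ≡⟨ cong (λ t → + (t C j)) (ℕ.+-suc s j) ⟩
  + ((suc s +ℕ j) C j)
    ∎
  where
  open ≡-Reasoning
  m : ℕ
  m = s +ℕ suc j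
  cancel : ∀ a b → (a + b) + - b ≡ a
  cancel = solve-∀

binomialBasis : ℕ → ℕ → ℕ → ℤ
binomialBasis p i x = + ((x +ℕ (p ∸ i)) C p)

binomialBasis-vanishes : ∀ {p i x} → x < i → i ≤ p → binomialBasis p i x ≡ 0ℤ
binomialBasis-vanishes {p} {i} {x} x<i i≤p = cong +_ (ℕCS.k>n⇒nCk≡0 (begin-strict
  x +ℕ (p ∸ i)   <⟨ ℕ.+-monoˡ-< (p ∸ i) x<i ⟩
  i +ℕ (p ∸ i)   ≡⟨ ℕ.m+[n∸m]≡n i≤p ⟩
  p              ∎))
  where open ℕ.≤-Reasoning

binomialBasis-diagonal : ∀ {p k} → k ≤ p → binomialBasis p k k ≡ 1ℤ
binomialBasis-diagonal {p} k≤p rewrite ℕ.m+[n∸m]≡n k≤p | ℕC.nCn≡1 p = refl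

binomialExpansion-at : ∀ p (u : ℕ → ℤ) {k} → k ≤ p →
  sumTo (suc p) (λ i → u i * binomialBasis p i k) ≡
  sumTo k (λ i → u i * binomialBasis p i k) + u k
binomialExpansion-at p u {k} k≤p = begin
  sumTo (suc p) (λ i → u i * binomialBasis p i k)
    ≡⟨ sumTo-truncate (s≤s k≤p) aboveDiagonal ⟩
  below + u k * binomialBasis p k k
    ≡⟨ cong (λ b → below + u k * b) (binomialBasis-diagonal k≤p) ⟩
  below + u k * 1ℤ
    ≡⟨ cong (_+_ below) (ℤ.*-identityʳ (u k)) ⟩
  below + u k
    ∎
  where
  open ≡-Reasoning
  below : ℤ
  below = sumTo k (λ i → u i * binomialBasis p i k)
  aboveDiagonal : ∀ i → suc k ≤ i → i < suc p → u i * binomialBasis p i k ≡ 0ℤ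
  aboveDiagonal i k<i (s≤s i≤p) =
    trans (cong (u i *_) (binomialBasis-vanishes k<i i≤p)) (ℤ.*-zeroʳ (u i))

binomialExpansion-unique : ∀ p (u v : ℕ → ℤ) →
  (∀ x → x ≤ p → sumTo (suc p) (λ i → u i * binomialBasis p i x) ≡
                 sumTo (suc p) (λ i → v i * binomialBasis p i x)) →
  ∀ k → k ≤ p → u k ≡ v k
binomialExpansion-unique p u v agree = <-rec _ step
  where
  step : ∀ k → (∀ {i} → i < k → i ≤ p → u i ≡ v i) → k ≤ p → u k ≡ v k
  step k ih k≤p = ∙-cancelˡ (sumTo k (λ i → u i * binomialBasis p i k)) (u k) (v k) (begin
    sumTo k (λ i → u i * binomialBasis p i k) + u k
      ≡⟨ binomialExpansion-at p u k≤p ⟨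
    sumTo (suc p) (λ i → u i * binomialBasis p i k)
      ≡⟨ agree k k≤p ⟩
    sumTo (suc p) (λ i → v i * binomialBasis p i k)
      ≡⟨ binomialExpansion-at p v k≤p ⟩
    sumTo k (λ i → v i * binomialBasis p i k) + v k
      ≡⟨ cong (_+ v k) (sumTo-cong k (λ i i<k →
           cong (_* binomialBasis p i k) (ih i<k (ℕ.<⇒≤ (ℕ.<-≤-trans i<k k≤p))))) ⟨
    sumTo k (λ i → u i * binomialBasis p i k) + v k
      ∎)
    where open ≡-Reasoning

inversionTerm : ℕ → ℕ → ℕ → ℕ → ℤ
inversionTerm p x j i = signPow (i ∸ j) * (+ ((p ∸ j) C (p ∸ i)) * binomialBasis p i x)

inversionKernel : ℕ → ℕ → ℕ → ℤ
inversionKernel p x j = sumTo (suc p) (inversionTerm p x j)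

inversionTerm-below : ∀ {p x i j} → i < j → j ≤ p → inversionTerm p x j i ≡ 0ℤ
inversionTerm-below {p} {x} {i} {j} i<j j≤p
  rewrite C-∸-vanishes i<j j≤p = ℤ.*-zeroʳ (signPow (i ∸ j))

inversionTerm-above : ∀ {p x i j} → x < i → i ≤ p → inversionTerm p x j i ≡ 0ℤ
inversionTerm-above {p} {x} {i} {j} x<i i≤p =
  trans (cong (λ b → σ * (c * b)) (binomialBasis-vanishes x<i i≤p)) (annihilate σ c)
  where
  σ c : ℤ
  σ = signPow (i ∸ j)
  c = + ((p ∸ j) C (p ∸ i))
  annihilate : ∀ σ c → σ * (c * 0ℤ) ≡ 0ℤ
  annihilate = solve-∀

a+[b∸c]≡[a∸c]+b : ∀ {a b c} → c ≤ a → c ≤ b → a +ℕ (b ∸ c) ≡ (a ∸ c) +ℕ b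
a+[b∸c]≡[a∸c]+b {a} {b} c≤a c≤b = trans (sym (ℕ.+-∸-assoc a c≤b)) (ℕ.+-∸-comm b c≤a)

inversionTerm-shift : ∀ {p x j r} → j +ℕ r ≤ x → x ≤ p →
  inversionTerm p x j (j +ℕ r) ≡
  signPow r * (+ ((p ∸ j) C r) * + ((x ∸ j ∸ r +ℕ p) C p))
inversionTerm-shift {p} {x} {j} {r} j+r≤x x≤p =
  cong₂ _*_ (cong signPow (ℕ.m+n∸m≡n j r)) (cong₂ (λ c b → + c * + b)
    (begin
      (p ∸ j) C (p ∸ (j +ℕ r))    ≡⟨ cong ((p ∸ j) C_) (ℕ.∸-+-assoc p j r) ⟨
      (p ∸ j) C (p ∸ j ∸ r)       ≡⟨ ℕC.nCk≡nC[n∸k] r≤p∸j ⟨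
      (p ∸ j) C r                 ∎)
    (cong (_C p) (begin
      x +ℕ (p ∸ (j +ℕ r))         ≡⟨ a+[b∸c]≡[a∸c]+b j+r≤x (ℕ.≤-trans j+r≤x x≤p) ⟩
      x ∸ (j +ℕ r) +ℕ p           ≡⟨ cong (_+ℕ p) (ℕ.∸-+-assoc x j r) ⟨
      x ∸ j ∸ r +ℕ p              ∎)))
  where
  open ≡-Reasoning
  r≤p∸j : r ≤ p ∸ j
  r≤p∸j = ℕ.≤-trans (ℕ.≤-reflexive (sym (ℕ.m+n∸m≡n j r)))
                    (ℕ.∸-monoˡ-≤ j (ℕ.≤-trans j+r≤x x≤p))

inversionKernel-≡-C : ∀ {p x j} → j ≤ p → x ≤ p → inversionKernel p x j ≡ + (x C j)
inversionKernel-≡-C {p} {x} {j} j≤p x≤p with j ℕ.≤? x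
... | no j≰x = trans (sumTo-0 (suc p) vanishes) (cong +_ (sym (ℕCS.k>n⇒nCk≡0 (ℕ.≰⇒> j≰x))))
  where
  vanishes : ∀ i → i < suc p → inversionTerm p x j i ≡ 0ℤ
  vanishes i (s≤s i≤p) with i ℕ.≤? x
  ... | yes i≤x = inversionTerm-below {x = x} {j = j} (ℕ.≤-<-trans i≤x (ℕ.≰⇒> j≰x)) j≤p
  ... | no  i≰x = inversionTerm-above {j = j} (ℕ.≰⇒> i≰x) i≤p
... | yes j≤x = begin
  sumTo (suc p) term
    ≡⟨ sumTo-truncate (s≤s x≤p) (λ i x<i i<1+p →
         inversionTerm-above {j = j} x<i (ℕ.≤-pred i<1+p)) ⟩
  sumTo (suc x) term
    ≡⟨ cong (λ m → sumTo m term) (trans (ℕ.+-suc j s) (cong suc (ℕ.m+[n∸m]≡n j≤x))) ⟨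
  sumTo (j +ℕ suc s) term
    ≡⟨ sumTo-split j (suc s) term ⟩
  sumTo j term + sumTo (suc s) (λ r → term (j +ℕ r))
    ≡⟨ cong₂ _+_ (sumTo-0 j (λ i i<j → inversionTerm-below {x = x} i<j j≤p))
                 (sumTo-cong (suc s) (λ r r<1+s →
                    inversionTerm-shift {j = j} {r = r} (j+r≤x (ℕ.≤-pred r<1+s)) x≤p)) ⟩
  0ℤ + alternatingConvolution (p ∸ j) p s
    ≡⟨ ℤ.+-identityˡ _ ⟩
  alternatingConvolution (p ∸ j) p s
    ≡⟨ cong (λ M → alternatingConvolution (p ∸ j) M s) (ℕ.m∸n+n≡m j≤p) ⟨
  alternatingConvolution (p ∸ j) (p ∸ j +ℕ j) s
    ≡⟨ alternatingConvolution-collapse (p ∸ j) j s ⟩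
  + ((s +ℕ j) C j)
    ≡⟨ cong (λ m → + (m C j)) (ℕ.m∸n+n≡m j≤x) ⟩
  + (x C j)
    ∎
  where
  open ≡-Reasoning
  s : ℕ
  s = x ∸ j
  term : ℕ → ℤ
  term = inversionTerm p x j
  j+r≤x : ∀ {r} → r ≤ s → j +ℕ r ≤ x
  j+r≤x r≤s = ℕ.≤-trans (ℕ.+-monoʳ-≤ j r≤s) (ℕ.≤-reflexive (ℕ.m+[n∸m]≡n j≤x))

binomialCoefficientsOf : ℕ → (ℕ → ℤ) → ℕ → ℤ
binomialCoefficientsOf p a k =
  sumTo (suc k) (λ i → signPow (k ∸ i) * (+ ((p ∸ i) C (p ∸ k)) * (+ (i !) * a i)))

binomialCoefficientsOf-expansion : ∀ p (a : ℕ → ℤ) {x} → x ≤ p →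
  sumTo (suc p) (λ k → binomialCoefficientsOf p a k * binomialBasis p k x) ≡
  sumTo (suc p) (λ i → a i * + fall x i)
binomialCoefficientsOf-expansion p a {x} x≤p = begin
  sumTo (suc p) (λ k → binomialCoefficientsOf p a k * binomialBasis p k x)
    ≡⟨ sumTo-cong (suc p) (λ k k<1+p → expandRow k (ℕ.≤-pred k<1+p)) ⟩
  sumTo (suc p) (λ k → sumTo (suc p) (λ i → entry k i * binomialBasis p k x))
    ≡⟨ sumTo-comm (suc p) (suc p) (λ k i → entry k i * binomialBasis p k x) ⟩
  sumTo (suc p) (λ i → sumTo (suc p) (λ k → entry k i * binomialBasis p k x))
    ≡⟨ sumTo-cong (suc p) (λ i i<1+p → column i (ℕ.≤-pred i<1+p)) ⟩
  sumTo (suc p) (λ i → a i * + fall x i)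
    ∎
  where
  open ≡-Reasoning
  entry : ℕ → ℕ → ℤ
  entry k i = signPow (k ∸ i) * (+ ((p ∸ i) C (p ∸ k)) * (+ (i !) * a i))
  expandRow : ∀ k → k ≤ p →
    binomialCoefficientsOf p a k * binomialBasis p k x ≡
    sumTo (suc p) (λ i → entry k i * binomialBasis p k x)
  expandRow k k≤p = begin
    sumTo (suc k) (entry k) * binomialBasis p k x
      ≡⟨ cong (_* binomialBasis p k x) (sumTo-truncate (s≤s k≤p) aboveDiagonal) ⟨
    sumTo (suc p) (entry k) * binomialBasis p k x
      ≡⟨ sumTo-*ʳ (suc p) (entry k) (binomialBasis p k x) ⟨
    sumTo (suc p) (λ i → entry k i * binomialBasis p k x)
      ∎
    where
    aboveDiagonal : ∀ i → suc k ≤ i → i < suc p → entry k i ≡ 0ℤ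
    aboveDiagonal i k<i i<1+p rewrite C-∸-vanishes {p} k<i (ℕ.≤-pred i<1+p) =
      ℤ.*-zeroʳ (signPow (k ∸ i))
  regroup : ∀ σ c f a b → σ * (c * (f * a)) * b ≡ σ * (c * b) * (f * a)
  regroup = solve-∀
  column : ∀ i → i ≤ p →
    sumTo (suc p) (λ k → entry k i * binomialBasis p k x) ≡ a i * + fall x i
  column i i≤p = begin
    sumTo (suc p) (λ k → entry k i * binomialBasis p k x)
      ≡⟨ sumTo-cong (suc p) (λ k _ →
           regroup (signPow (k ∸ i)) (+ ((p ∸ i) C (p ∸ k))) (+ (i !)) (a i) (binomialBasis p k x)) ⟩
    sumTo (suc p) (λ k → inversionTerm p x i k * (+ (i !) * a i))
      ≡⟨ sumTo-*ʳ (suc p) (inversionTerm p x i) (+ (i !) * a i) ⟩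
    inversionKernel p x i * (+ (i !) * a i)
      ≡⟨ cong (_* (+ (i !) * a i)) (inversionKernel-≡-C i≤p x≤p) ⟩
    + (x C i) * (+ (i !) * a i)
      ≡⟨ reorder (+ (x C i)) (+ (i !)) (a i) ⟩
    a i * (+ (i !) * + (x C i))
      ≡⟨ cong (a i *_) (ℤ.pos-* (i !) (x C i)) ⟨
    a i * + (i ! *ℕ (x C i))
      ≡⟨ cong (λ m → a i * + m) (fall≡!*C x i) ⟨
    a i * + fall x i
      ∎
    where
    reorder : ∀ c f a → c * (f * a) ≡ a * (f * c)
    reorder = solve-∀

mainTheorem8 : (p : ℕ) (G : SimpleGraph p) (a w : ℕ → ℤ) →
  (∀ x → + chromatic G x ≡ sumTo (suc p) (λ i → a i * + fall x i)) →
  (∀ x → + chromatic G x ≡ sumTo (suc p) (λ i → w i * + ((x +ℕ (p ∸ i)) C p))) →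
  (k : ℕ) → k ≤ p →
  w k ≡ sumTo (suc k) (λ i → signPow (k ∸ i) * (+ ((p ∸ i) C (p ∸ k)) * (+ (i !) * a i)))
mainTheorem8 p G a w inFalling inBinomial k k≤p =
  sym (binomialExpansion-unique p (binomialCoefficientsOf p a) w agree k k≤p)
  where
  agree : ∀ x → x ≤ p →
    sumTo (suc p) (λ i → binomialCoefficientsOf p a i * binomialBasis p i x) ≡
    sumTo (suc p) (λ i → w i * binomialBasis p i x)
  agree x x≤p =
    trans (binomialCoefficientsOf-expansion p a x≤p) (trans (sym (inFalling x)) (inBinomial x))
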